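{- Let $m\in[p^k]$ and $b\in R^\times$. Then the function $x\mapsto\phi_m(bx)-b^m\phi_m(x)$ belongs to $\Omega_{m-1}$.
   Context: Let $p$ be prime, $k\in\mathbb{N}$, $R=\mathbb{Z}/p^k\mathbb{Z}$ with representatives $\{0,\dots,p^k-1\}$, $[m]=\{0,\dots,m-1\}$. For $j\in[p^k]$, $\phi_j(x)=\binom{x}{j}\bmod p$ (representative of $x$, $\binom{a}{b}=0$ for $a<b$). $\Omega_N=\operatorname{span}_{\mathbb{Z}/p\mathbb{Z}}\{\phi_j:0\le j\le N\}$, $\Omega_N=\{0\}$ for $N<0$. The scalar $b^m$ is interpreted as $(b\bmod p)^m\in\mathbb{Z}/p\mathbb{Z}$. -}

module Defs where

open import Data.Nat using (ℕ; zero; suc; _+_; _*_; _^_; _<_; NonZero)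
open import Data.Nat.DivMod using (_%_)
open import Data.Nat.Combinatorics using (_C_)
open import Data.Nat.Primality using (Prime)
open import Data.Nat.Coprimality using (Coprime)
open import Data.Product using (∃; _×_)
open import Relation.Binary.PropositionalEquality using (_≡_)

sumTo : ℕ → (ℕ → ℕ) → ℕ
sumTo zero    f = 0
sumTo (suc n) f = sumTo n f + f n

φ : (p : ℕ) → .{{NonZero p}} → ℕ → ℕ → ℕ
φ p j x = (x C j) % p

-- A function f : R → Z/pZ (given on representatives x ∈ [p^k], values
-- read mod p) lies in Ω_{n-1} = span{φ_j : 0 ≤ j < n}  (= {0} for n = 0).
InΩbelow : (p k : ℕ) → .{{NonZero p}} → ℕ → (ℕ → ℕ) → Set
InΩbelow p k n f =
  ∃ λ (c : ℕ → ℕ) → ∀ x → x < p ^ k →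
    f x % p ≡ sumTo n (λ j → c j * φ p j x) % p

module Submission where

-- Over ℕ, binom (b x + t) m = b^m binom x m + h x with h an ℕ-combination of the
-- binom x j, j < m: the forward difference in x of the left side is
-- Σ_{s<b} binom (b x + t + s) (m − 1), so induction on m and summation give the
-- expansion.  Reducing b x modulo p^k leaves binom (b x) m unchanged modulo p,
-- because binom (y + p^k) m = Σ_i binom (p^k) i · binom y (m − i) (Vandermonde)
-- and p divides binom (p^k) i for 0 < i < p^k.  Finally the leading term
-- b^m binom x m + (p − 1) b^m binom x m is divisible by p.

open import Defs
open import Data.Nat using (ℕ; zero; suc; _+_; _∸_; _*_; _^_; _<_; _≤_; NonZero; z≤n; s≤s)
open import Data.Nat.DivMod
  using (_%_; _/_; m≡m%n+[m/n]*n; m%n%n≡m%n; [m+kn]%n≡m%n; %-distribˡ-+; %-distribˡ-*; %-remove-+ˡ)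
open import Data.Nat.Properties
open import Data.Nat.Divisibility
open import Data.Nat.Combinatorics using (_C_; nCk+nC[k+1]≡[n+1]C[k+1]; k>n⇒nCk≡0)
open import Data.Nat.Primality using (Prime; euclidsLemma)
open import Data.Nat.Coprimality using (Coprime)
open import Data.Nat.Solver using (module +-*-Solver)
open import Data.Product using (∃; _×_; _,_; proj₁; proj₂)
open import Data.Sum using (inj₁; inj₂)
open import Data.Empty using (⊥-elim)
open import Relation.Nullary using (yes; no)
open import Level using (0ℓ)
open import Relation.Binary.Bundles using (Setoid)
open import Relation.Binary.Structures using (IsEquivalence)
open import Relation.Binary.PropositionalEquality
import Relation.Binary.Reasoning.Setoid as SetoidReasoning
open +-*-Solver

-- Pascal's recursion, so that binomial identities can be proved by induction
-- instead of through the factorial formula behind _C_.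
binom : ℕ → ℕ → ℕ
binom n       zero    = 1
binom zero    (suc k) = 0
binom (suc n) (suc k) = binom n k + binom n (suc k)

binom≡C : ∀ n k → binom n k ≡ n C k
binom≡C n       zero    = refl
binom≡C zero    (suc k) = sym (k>n⇒nCk≡0 {0} {suc k} (s≤s z≤n))
binom≡C (suc n) (suc k) =
  trans (cong₂ _+_ (binom≡C n k) (binom≡C n (suc k))) (nCk+nC[k+1]≡[n+1]C[k+1] n k)

binom-1 : ∀ n → binom n 1 ≡ n
binom-1 zero    = refl
binom-1 (suc n) = cong suc (binom-1 n)

sumTo-cong : ∀ n {f g : ℕ → ℕ} → (∀ j → f j ≡ g j) → sumTo n f ≡ sumTo n g
sumTo-cong zero    f≡g = refl
sumTo-cong (suc n) f≡g = cong₂ _+_ (sumTo-cong n f≡g) (f≡g n)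

sumTo-zero : ∀ n {f : ℕ → ℕ} → (∀ j → f j ≡ 0) → sumTo n f ≡ 0
sumTo-zero zero    f≡0 = refl
sumTo-zero (suc n) f≡0 = cong₂ _+_ (sumTo-zero n f≡0) (f≡0 n)

sumTo-const : ∀ n c → sumTo n (λ _ → c) ≡ n * c
sumTo-const zero    c = refl
sumTo-const (suc n) c = trans (cong (_+ c) (sumTo-const n c)) (+-comm (n * c) c)

sumTo-distrib-+ : ∀ n (f g : ℕ → ℕ) → sumTo n (λ j → f j + g j) ≡ sumTo n f + sumTo n g
sumTo-distrib-+ zero    f g = refl
sumTo-distrib-+ (suc n) f g =
  trans (cong (_+ (f n + g n)) (sumTo-distrib-+ n f g))
        (solve 4 (λ a b c d → (a :+ b) :+ (c :+ d) := (a :+ c) :+ (b :+ d)) refl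
               (sumTo n f) (sumTo n g) (f n) (g n))

sumTo-suc-head : ∀ n (f : ℕ → ℕ) → sumTo (suc n) f ≡ f 0 + sumTo n (λ j → f (suc j))
sumTo-suc-head zero    f = +-comm 0 (f 0)
sumTo-suc-head (suc n) f = trans (cong (_+ f (suc n)) (sumTo-suc-head n f)) (+-assoc (f 0) _ _)

sumTo-∣ : ∀ {d} n (f : ℕ → ℕ) → (∀ j → j < n → d ∣ f j) → d ∣ sumTo n f
sumTo-∣ zero    f d∣f = divides 0 refl
sumTo-∣ (suc n) f d∣f =
  ∣m∣n⇒∣m+n (sumTo-∣ n f (λ j j<n → d∣f j (m<n⇒m<1+n j<n))) (d∣f n (n<1+n n))

BinomSpan : ℕ → (ℕ → ℕ) → Set
BinomSpan n g = ∃ λ (c : ℕ → ℕ) → ∀ x → g x ≡ sumTo n (λ j → c j * binom x j)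

BinomSpan-0 : ∀ n → BinomSpan n (λ _ → 0)
BinomSpan-0 n = (λ _ → 0) , λ x → sym (sumTo-zero n (λ j → refl))

BinomSpan-+ : ∀ {n g h} → BinomSpan n g → BinomSpan n h → BinomSpan n (λ x → g x + h x)
BinomSpan-+ {n} (c , g≡) (d , h≡) = (λ j → c j + d j) , λ x →
  trans (cong₂ _+_ (g≡ x) (h≡ x))
    (sym (trans (sumTo-cong n (λ j → *-distribʳ-+ (binom x j) (c j) (d j)))
                (sumTo-distrib-+ n _ _)))

BinomSpan-sumTo : ∀ {n} b (F : ℕ → ℕ → ℕ) → (∀ s → BinomSpan n (F s)) →
  BinomSpan n (λ x → sumTo b (λ s → F s x))
BinomSpan-sumTo {n} zero    F F∈ = BinomSpan-0 n
BinomSpan-sumTo {n} (suc b) F F∈ = BinomSpan-+ {n} (BinomSpan-sumTo {n} b F F∈) (F∈ b)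

-- Hockey stick: Σ_{y<x} binom y j = binom x (suc j).
BinomSpan-partialSums : ∀ {n h} s → BinomSpan n h → BinomSpan (suc n) (λ x → s + sumTo x h)
BinomSpan-partialSums {n} {h} s (c , h≡) = c′ , λ x →
  trans (cong₂ _+_ (sym (*-identityʳ s)) (partialSums x))
        (sym (sumTo-suc-head n (λ j → c′ j * binom x j)))
  where
  c′ : ℕ → ℕ
  c′ zero    = s
  c′ (suc j) = c j
  partialSums : ∀ x → sumTo x h ≡ sumTo n (λ j → c j * binom x (suc j))
  partialSums zero    = sym (sumTo-zero n (λ j → *-zeroʳ (c j)))
  partialSums (suc x) = begin
      sumTo x h + h x
    ≡⟨ cong₂ _+_ (partialSums x) (h≡ x) ⟩
      sumTo n (λ j → c j * binom x (suc j)) + sumTo n (λ j → c j * binom x j)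
    ≡⟨ sym (sumTo-distrib-+ n _ _) ⟩
      sumTo n (λ j → c j * binom x (suc j) + c j * binom x j)
    ≡⟨ sumTo-cong n (λ j → trans (+-comm (c j * binom x (suc j)) _)
                                 (sym (*-distribˡ-+ (c j) (binom x j) (binom x (suc j))))) ⟩
      sumTo n (λ j → c j * binom (suc x) (suc j))
    ∎
    where open ≡-Reasoning

difference-equation : ∀ {n} (g h : ℕ → ℕ) (a : ℕ) → BinomSpan n h →
  (∀ x → g (suc x) ≡ g x + (a * binom x n + h x)) →
  ∃ λ k → BinomSpan (suc n) k × (∀ x → g x ≡ a * binom x (suc n) + k x)
difference-equation {n} g h a h∈ Δg = k , BinomSpan-partialSums (g 0) h∈ , g≡
  where
  k : ℕ → ℕ
  k x = g 0 + sumTo x h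
  g≡ : ∀ x → g x ≡ a * binom x (suc n) + k x
  g≡ zero    = solve 2 (λ a g₀ → g₀ := a :* con 0 :+ (g₀ :+ con 0)) refl a (g 0)
  g≡ (suc x) = trans (Δg x) (trans (cong (_+ (a * binom x n + h x)) (g≡ x))
    (solve 6 (λ a B₀ B₁ g₀ S hₓ → (a :* B₁ :+ (g₀ :+ S)) :+ (a :* B₀ :+ hₓ)
                                  := a :* (B₀ :+ B₁) :+ (g₀ :+ (S :+ hₓ)))
           refl a (binom x n) (binom x (suc n)) (g 0) (sumTo x h) (h x)))

binom-+-telescope : ∀ y b n →
  binom (y + b) (suc n) ≡ binom y (suc n) + sumTo b (λ s → binom (y + s) n)
binom-+-telescope y zero    n =
  trans (cong (λ z → binom z (suc n)) (+-identityʳ y)) (sym (+-identityʳ _))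
binom-+-telescope y (suc b) n rewrite +-suc y b =
  trans (cong (binom (y + b) n +_) (binom-+-telescope y b n))
        (solve 3 (λ a b c → a :+ (b :+ c) := b :+ (c :+ a)) refl
               (binom (y + b) n) (binom y (suc n)) (sumTo b (λ s → binom (y + s) n)))

binom-affine : ∀ b m t →
  ∃ λ h → BinomSpan m h × (∀ x → binom (b * x + t) m ≡ b ^ m * binom x m + h x)
binom-affine b zero    t = (λ _ → 0) , BinomSpan-0 zero , λ x → refl
binom-affine b (suc n) t = difference-equation g d (b ^ suc n) d∈ Δg
  where
  lower : ℕ → ℕ → ℕ
  lower u = proj₁ (binom-affine b n u)
  d : ℕ → ℕ
  d x = sumTo b (λ s → lower (t + s) x)
  d∈ : BinomSpan n d
  d∈ = BinomSpan-sumTo {n} b (λ s → lower (t + s))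
                        (λ s → proj₁ (proj₂ (binom-affine b n (t + s))))
  g : ℕ → ℕ
  g x = binom (b * x + t) (suc n)
  Δg : ∀ x → g (suc x) ≡ g x + (b ^ suc n * binom x n + d x)
  Δg x = begin
      binom (b * suc x + t) (suc n)
    ≡⟨ cong (λ z → binom z (suc n))
            (trans (cong (_+ t) (*-suc b x))
                   (solve 3 (λ b y t → (b :+ y) :+ t := (y :+ t) :+ b) refl b (b * x) t)) ⟩
      binom (b * x + t + b) (suc n)
    ≡⟨ binom-+-telescope (b * x + t) b n ⟩
      g x + sumTo b (λ s → binom (b * x + t + s) n)
    ≡⟨ cong (g x +_) (sumTo-cong b (λ s → trans (cong (λ z → binom z n) (+-assoc (b * x) t s))
                                                (proj₂ (proj₂ (binom-affine b n (t + s))) x))) ⟩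
      g x + sumTo b (λ s → b ^ n * binom x n + lower (t + s) x)
    ≡⟨ cong (g x +_) (sumTo-distrib-+ b _ _) ⟩
      g x + (sumTo b (λ s → b ^ n * binom x n) + d x)
    ≡⟨ cong (λ z → g x + (z + d x)) (trans (sumTo-const b _) (sym (*-assoc b (b ^ n) (binom x n)))) ⟩
      g x + (b ^ suc n * binom x n + d x)
    ∎
    where open ≡-Reasoning

vandermonde : ∀ N y m → binom (y + N) m ≡ sumTo (suc m) (λ i → binom N i * binom y (m ∸ i))
vandermonde zero y m = begin
    binom (y + 0) m
  ≡⟨ cong (λ z → binom z m) (+-identityʳ y) ⟩
    binom y m
  ≡⟨ sym (trans (cong₂ _+_ (+-identityʳ (binom y m)) (sumTo-zero m (λ j → refl)))
               (+-identityʳ _)) ⟩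
    1 * binom y m + sumTo m (λ i → binom 0 (suc i) * binom y (m ∸ suc i))
  ≡⟨ sym (sumTo-suc-head m _) ⟩
    sumTo (suc m) (λ i → binom 0 i * binom y (m ∸ i))
  ∎
  where open ≡-Reasoning
vandermonde (suc N) y zero = refl
vandermonde (suc N) y (suc m) rewrite +-suc y N = begin
    binom (y + N) m + binom (y + N) (suc m)
  ≡⟨ cong₂ _+_ (vandermonde N y m) (trans (vandermonde N y (suc m)) (sumTo-suc-head (suc m) _)) ⟩
    A + (1 * Y + C)
  ≡⟨ solve 3 (λ a y c → a :+ (y :+ c) := y :+ (a :+ c)) refl A (1 * Y) C ⟩
    1 * Y + (A + C)
  ≡⟨ cong (1 * Y +_) (sym (trans (sumTo-cong (suc m) λ i →
                                    *-distribʳ-+ (binom y (m ∸ i)) (binom N i) (binom N (suc i)))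
                                 (sumTo-distrib-+ (suc m) _ _))) ⟩
    1 * Y + sumTo (suc m) (λ i → binom (suc N) (suc i) * binom y (m ∸ i))
  ≡⟨ sym (sumTo-suc-head (suc m) _) ⟩
    sumTo (suc (suc m)) (λ i → binom (suc N) i * binom y (suc m ∸ i))
  ∎
  where
  open ≡-Reasoning
  A Y C : ℕ
  A = sumTo (suc m) (λ i → binom N i * binom y (m ∸ i))
  Y = binom y (suc m)
  C = sumTo (suc m) (λ i → binom N (suc i) * binom y (m ∸ i))

binom-absorption : ∀ n k → suc k * binom (suc n) (suc k) ≡ suc n * binom n k
binom-absorption n       zero    = trans (*-identityˡ _) (trans (binom-1 (suc n)) (sym (*-identityʳ _)))
binom-absorption zero    (suc k) = *-zeroʳ (suc (suc k))
binom-absorption (suc n) (suc k) = begin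
    suc (suc k) * (B₀ + B₁ + B₂)
  ≡⟨ solve 4 (λ k b₀ b₁ b₂ → (con 2 :+ k) :* (b₀ :+ b₁ :+ b₂)
                            := (b₀ :+ b₁) :+ ((con 1 :+ k) :* (b₀ :+ b₁) :+ (con 2 :+ k) :* b₂))
           refl k B₀ B₁ B₂ ⟩
    (B₀ + B₁) + (suc k * (B₀ + B₁) + suc (suc k) * B₂)
  ≡⟨ cong ((B₀ + B₁) +_) (cong₂ _+_ (binom-absorption n k) (binom-absorption n (suc k))) ⟩
    (B₀ + B₁) + (suc n * B₀ + suc n * B₁)
  ≡⟨ solve 3 (λ n b₀ b₁ → (b₀ :+ b₁) :+ ((con 1 :+ n) :* b₀ :+ (con 1 :+ n) :* b₁)
                         := (con 2 :+ n) :* (b₀ :+ b₁))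
           refl n B₀ B₁ ⟩
    suc (suc n) * (B₀ + B₁)
  ∎
  where
  open ≡-Reasoning
  B₀ B₁ B₂ : ℕ
  B₀ = binom n k
  B₁ = binom n (suc k)
  B₂ = binom (suc n) (suc (suc k))

module Congruence (p : ℕ) .{{_ : NonZero p}} where

  infix 4 _≈_
  record _≈_ (a b : ℕ) : Set where
    constructor mod-≡
    field %-≡ : a % p ≡ b % p
  open _≈_ public

  ≈-isEquivalence : IsEquivalence _≈_
  ≈-isEquivalence = record
    { refl  = mod-≡ refl
    ; sym   = λ (mod-≡ a≡b) → mod-≡ (sym a≡b)
    ; trans = λ (mod-≡ a≡b) (mod-≡ b≡c) → mod-≡ (trans a≡b b≡c)
    }

  ≈-setoid : Setoid 0ℓ 0ℓ
  ≈-setoid = record { isEquivalence = ≈-isEquivalence }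

  %-≈ : ∀ a → a % p ≈ a
  %-≈ a = mod-≡ (m%n%n≡m%n a p)

  ≈-+ : ∀ {a a′ b b′} → a ≈ a′ → b ≈ b′ → a + b ≈ a′ + b′
  ≈-+ {a} {a′} {b} {b′} (mod-≡ a≡) (mod-≡ b≡) = mod-≡
    (trans (%-distribˡ-+ a b p)
    (trans (cong₂ (λ u v → (u + v) % p) a≡ b≡)
           (sym (%-distribˡ-+ a′ b′ p))))

  ≈-* : ∀ {a a′ b b′} → a ≈ a′ → b ≈ b′ → a * b ≈ a′ * b′
  ≈-* {a} {a′} {b} {b′} (mod-≡ a≡) (mod-≡ b≡) = mod-≡
    (trans (%-distribˡ-* a b p)
    (trans (cong₂ (λ u v → (u * v) % p) a≡ b≡)
           (sym (%-distribˡ-* a′ b′ p))))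

  ≈-*ˡ : ∀ a {b b′} → b ≈ b′ → a * b ≈ a * b′
  ≈-*ˡ a = ≈-* (mod-≡ {a} refl)

  ≈-^ : ∀ {a a′} m → a ≈ a′ → a ^ m ≈ a′ ^ m
  ≈-^ zero    a≈ = mod-≡ refl
  ≈-^ (suc m) a≈ = ≈-* a≈ (≈-^ m a≈)

  sumTo-≈ : ∀ n {f g : ℕ → ℕ} → (∀ j → f j ≈ g j) → sumTo n f ≈ sumTo n g
  sumTo-≈ zero    f≈g = mod-≡ refl
  sumTo-≈ (suc n) f≈g = ≈-+ (sumTo-≈ n f≈g) (f≈g n)

  a+h+[p∸1]*a≈h : ∀ a h → a + h + (p ∸ 1) * a ≈ h
  a+h+[p∸1]*a≈h a h = mod-≡ (begin
      (a + h + (p ∸ 1) * a) % p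
    ≡⟨ cong (_% p) (solve 3 (λ a h q → a :+ h :+ q :* a := h :+ a :* (con 1 :+ q))
                            refl a h (p ∸ 1)) ⟩
      (h + a * suc (p ∸ 1)) % p
    ≡⟨ cong (λ n → (h + a * n) % p) (suc-pred p) ⟩
      (h + a * p) % p
    ≡⟨ [m+kn]%n≡m%n h a p ⟩
      h % p
    ∎)
    where open ≡-Reasoning

  φ≈binom : ∀ j x → φ p j x ≈ binom x j
  φ≈binom j x = mod-≡ (trans (m%n%n≡m%n (x C j) p) (cong (_% p) (sym (binom≡C x j))))

module _ {p : ℕ} .{{_ : NonZero p}} (p-prime : Prime p) where

  open Congruence p

  p^e∣m*n⇒p^e∣m : ∀ e m n → p ∤ n → p ^ e ∣ m * n → p ^ e ∣ m
  p^e∣m*n⇒p^e∣m zero    m n p∤n _ = 1∣ m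
  p^e∣m*n⇒p^e∣m (suc e) m n p∤n p^[1+e]∣m*n
    with euclidsLemma m n p-prime (m*n∣⇒m∣ p (p ^ e) p^[1+e]∣m*n)
  ... | inj₂ p∣n = ⊥-elim (p∤n p∣n)
  ... | inj₁ (divides q refl) = subst (p ^ suc e ∣_) (*-comm p q) (*-monoʳ-∣ p p^e∣q)
    where
    p^e∣q : p ^ e ∣ q
    p^e∣q = p^e∣m*n⇒p^e∣m e q n p∤n (*-cancelˡ-∣ p
              (subst (p ^ suc e ∣_) (trans (cong (_* n) (*-comm q p)) (*-assoc p q n)) p^[1+e]∣m*n))

  -- If p ∤ binom (p^e) i then absorption i · binom (p^e) i = p^e · binom (p^e − 1) (i − 1)
  -- forces p^e ∣ i, impossible for 0 < i < p^e.
  p∣binom[p^e,i] : ∀ e i → 0 < i → i < p ^ e → p ∣ binom (p ^ e) i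
  p∣binom[p^e,i] e (suc j) _ j<p^e with p ^ e in p^e≡
  ... | zero  = ⊥-elim (n≮0 j<p^e)
  ... | suc n with p ∣? binom (suc n) (suc j)
  ...   | yes p∣binom = p∣binom
  ...   | no  p∤binom = ⊥-elim (<⇒≱ j<p^e (subst (_≤ suc j) p^e≡ (∣⇒≤ p^e∣suc-j)))
    where
    p^e∣suc-j : p ^ e ∣ suc j
    p^e∣suc-j = p^e∣m*n⇒p^e∣m e (suc j) _ p∤binom
      (divides (binom n j) (trans (binom-absorption n j)
                                  (trans (*-comm (suc n) _) (cong (binom n j *_) (sym p^e≡)))))

  binom-+p^e-≈ : ∀ e y m → m < p ^ e → binom (y + p ^ e) m ≈ binom y m
  binom-+p^e-≈ e y m m<p^e = mod-≡ (begin
      binom (y + p ^ e) m % p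
    ≡⟨ cong (_% p) (trans (vandermonde (p ^ e) y m) (sumTo-suc-head m _)) ⟩
      (1 * binom y m + higher) % p
    ≡⟨ cong (_% p) (+-comm (1 * binom y m) higher) ⟩
      (higher + 1 * binom y m) % p
    ≡⟨ %-remove-+ˡ (1 * binom y m) (sumTo-∣ m _ λ j j<m →
         ∣m⇒∣m*n _ (p∣binom[p^e,i] e (suc j) (s≤s z≤n) (≤-<-trans j<m m<p^e))) ⟩
      (1 * binom y m) % p
    ≡⟨ cong (_% p) (*-identityˡ _) ⟩
      binom y m % p
    ∎)
    where
    open ≡-Reasoning
    higher : ℕ
    higher = sumTo m (λ i → binom (p ^ e) (suc i) * binom y (m ∸ suc i))

  binom-+q*p^e-≈ : ∀ e m → m < p ^ e → ∀ q y → binom (y + q * p ^ e) m ≈ binom y m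
  binom-+q*p^e-≈ e m m<p^e zero    y = mod-≡ (cong (λ z → binom z m % p) (+-identityʳ y))
  binom-+q*p^e-≈ e m m<p^e (suc q) y = begin
      binom (y + (p ^ e + q * p ^ e)) m
    ≡⟨ cong (λ z → binom z m) (solve 3 (λ y P Q → y :+ (P :+ Q) := (y :+ Q) :+ P)
                                       refl y (p ^ e) (q * p ^ e)) ⟩
      binom (y + q * p ^ e + p ^ e) m
    ≈⟨ binom-+p^e-≈ e (y + q * p ^ e) m m<p^e ⟩
      binom (y + q * p ^ e) m
    ≈⟨ binom-+q*p^e-≈ e m m<p^e q y ⟩
      binom y m
    ∎
    where open SetoidReasoning ≈-setoid

  φ[y%p^k]≈binom : ∀ k .{{_ : NonZero (p ^ k)}} m → m < p ^ k →
                   ∀ y → φ p m (y % p ^ k) ≈ binom y m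
  φ[y%p^k]≈binom k m m<p^k y = begin
      φ p m (y % p ^ k)
    ≈⟨ φ≈binom m (y % p ^ k) ⟩
      binom (y % p ^ k) m
    ≈⟨ binom-+q*p^e-≈ k m m<p^k (y / p ^ k) (y % p ^ k) ⟨
      binom (y % p ^ k + y / p ^ k * p ^ k) m
    ≡⟨ cong (λ z → binom z m) (m≡m%n+[m/n]*n y (p ^ k)) ⟨
      binom y m
    ∎
    where open SetoidReasoning ≈-setoid

lemma4p7 : (p k : ℕ) → .{{_ : NonZero p}} → .{{_ : NonZero (p ^ k)}} → Prime p →
    (m : ℕ) → m < p ^ k → (b : ℕ) → b < p ^ k → Coprime b (p ^ k) →
    InΩbelow p k m
      (λ x → φ p m ((b * x) % (p ^ k)) + (p ∸ 1) * ((b % p) ^ m * φ p m x))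
lemma4p7 p k p-prime m m<p^k b _ _ with binom-affine b m 0
... | h , (c , h≡) , expand = c , λ x _ → %-≡ (begin
      φ p m (b * x % p ^ k) + (p ∸ 1) * ((b % p) ^ m * φ p m x)
    ≈⟨ ≈-+ (φ[y%p^k]≈binom p-prime k m m<p^k (b * x))
           (≈-*ˡ (p ∸ 1) (≈-* (≈-^ m (%-≈ b)) (φ≈binom m x))) ⟩
      binom (b * x) m + (p ∸ 1) * (b ^ m * binom x m)
    ≡⟨ cong (λ y → binom y m + (p ∸ 1) * (b ^ m * binom x m)) (+-identityʳ (b * x)) ⟨
      binom (b * x + 0) m + (p ∸ 1) * (b ^ m * binom x m)
    ≡⟨ cong (_+ (p ∸ 1) * (b ^ m * binom x m)) (expand x) ⟩
      b ^ m * binom x m + h x + (p ∸ 1) * (b ^ m * binom x m)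
    ≈⟨ a+h+[p∸1]*a≈h (b ^ m * binom x m) (h x) ⟩
      h x
    ≡⟨ h≡ x ⟩
      sumTo m (λ j → c j * binom x j)
    ≈⟨ sumTo-≈ m (λ j → ≈-*ˡ (c j) (φ≈binom j x)) ⟨
      sumTo m (λ j → c j * φ p j x)
    ∎)
  where
  open Congruence p
  open SetoidReasoning ≈-setoid
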